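{- The graphs $G_3$ and $G_4$ are Ramanujan graphs: for each of them, every eigenvalue $\lambda$ of the adjacency matrix with $\lambda\neq\pm 6$ satisfies $|\lambda|\le 2\sqrt{5}$.
   Context: Let $P$ be the Petersen graph on vertex set $\{0,1,\dots,9\}$ whose 15 edges are the unordered pairs underlying the following set of directed edges (an orientation $\vec P$ of $P$): $E(\vec P)=\{(0,1),(0,4),(0,5),(1,2),(1,6),(2,3),(2,7),(3,4),(3,8),(4,9),(5,7),(5,8),(6,8),(6,9),(7,9)\}$. For $n\ge 3$ let $\sigma$ be the cyclic permutation of $\{1,\dots,n\}$ given by $\sigma(i)=i+1$ for $i<n$ and $\sigma(n)=1$. The graph $G_n$ is the simple undirected graph with vertex set $\{(i,x):1\le i\le n,\ 0\le x\le 9\}$ in which $(i,x)\sim(i,y)$ whenever $\{x,y\}$ is an edge of $P$, and $(i,x)\sim(\sigma(i),y)$ whenever $(x,y)\in E(\vec P)$. A $d$-regular graph is Ramanujan if every adjacency eigenvalue $\lambda\ne\pm d$ satisfies $|\lambda|\le 2\sqrt{d-1}$; here $d=6$. -}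

module Defs where

open import Level using (Level; _⊔_) renaming (suc to lsuc)
open import Algebra.Bundles using (CommutativeRing)
open import Relation.Binary.Structures using (IsTotalOrder)
open import Relation.Nullary using (¬_)
open import Data.Product using (_×_; _,_; ∃; ∃-syntax)
open import Data.Nat using (ℕ; zero; suc; _≡ᵇ_)
open import Data.Bool using (Bool; true; false; _∧_; _∨_; if_then_else_)
open import Data.Fin using (Fin; toℕ)
open import Data.List using (List; []; _∷_)
open import Data.Bool.ListAction using (any)

-- Ordered fields.  The paper's eigenvalues live in ℝ, which the library
-- lacks; we quantify over every ordered field (ℝ is one of them).

record OrderedField c ℓ₁ ℓ₂ : Set (lsuc (c ⊔ ℓ₁ ⊔ ℓ₂)) where
  field
    commutativeRing : CommutativeRing c ℓ₁
  open CommutativeRing commutativeRing public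
  field
    _≤_          : Carrier → Carrier → Set ℓ₂
    isTotalOrder : IsTotalOrder _≈_ _≤_
    nontrivial   : ¬ (0# ≈ 1#)
    inverse      : ∀ x → ¬ (x ≈ 0#) → ∃[ y ] (x * y ≈ 1#)
    +-mono-≤     : ∀ {x y} z → x ≤ y → (x + z) ≤ (y + z)
    *-nonneg     : ∀ {x y} → 0# ≤ x → 0# ≤ y → 0# ≤ (x * y)

  fromℕ : ℕ → Carrier
  fromℕ zero    = 0#
  fromℕ (suc k) = 1# + fromℕ k

  sumFin : ∀ {k} → (Fin k → Carrier) → Carrier
  sumFin {zero}  f = 0#
  sumFin {suc k} f = f Fin.zero + sumFin (λ i → f (Fin.suc i))

petersenArcs : List (ℕ × ℕ)
petersenArcs =
  (0 , 1) ∷ (0 , 4) ∷ (0 , 5) ∷ (1 , 2) ∷ (1 , 6) ∷ (2 , 3) ∷ (2 , 7) ∷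
  (3 , 4) ∷ (3 , 8) ∷ (4 , 9) ∷ (5 , 7) ∷ (5 , 8) ∷ (6 , 8) ∷ (6 , 9) ∷
  (7 , 9) ∷ []

arc : Fin 10 → Fin 10 → Bool
arc x y = any (λ { (a , b) → (a ≡ᵇ toℕ x) ∧ (b ≡ᵇ toℕ y) }) petersenArcs

pEdge : Fin 10 → Fin 10 → Bool
pEdge x y = arc x y ∨ arc y x

-- The graph G_n.  Layers are indexed by Fin n (layer i here is layer
-- i+1 of the paper), so σ becomes i ↦ i+1 mod n.

σRel : (n : ℕ) → Fin n → Fin n → Bool
σRel n i j = (suc (toℕ i) ≡ᵇ toℕ j) ∨ ((suc (toℕ i) ≡ᵇ n) ∧ (toℕ j ≡ᵇ 0))

Vertex : ℕ → Set
Vertex n = Fin n × Fin 10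

adjG : (n : ℕ) → Vertex n → Vertex n → Bool
adjG n (i , x) (j , y) =
  ((toℕ i ≡ᵇ toℕ j) ∧ pEdge x y) ∨ (σRel n i j ∧ arc x y) ∨ (σRel n j i ∧ arc y x)

module _ {c ℓ₁ ℓ₂} (F : OrderedField c ℓ₁ ℓ₂) where
  open OrderedField F

  adjMatrix : (n : ℕ) → Vertex n → Vertex n → Carrier
  adjMatrix n u w = if adjG n u w then 1# else 0#

  adjMul : (n : ℕ) → (Vertex n → Carrier) → Vertex n → Carrier
  adjMul n v (i , x) =
    sumFin (λ j → sumFin (λ y → adjMatrix n (i , x) (j , y) * v (j , y)))

  IsAdjEigenvalue : (n : ℕ) → Carrier → Set (c ⊔ ℓ₁)
  IsAdjEigenvalue n λ′ =
    ∃[ v ] ((∃[ u ] ¬ (v u ≈ 0#)) × (∀ u → adjMul n v u ≈ λ′ * v u))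

  -- G_n (6-regular) is Ramanujan: every eigenvalue λ ≠ ±6 has |λ| ≤ 2√5,
  -- i.e. λ² ≤ 20.
  IsRamanujanG : (n : ℕ) → Set (c ⊔ ℓ₁ ⊔ ℓ₂)
  IsRamanujanG n = ∀ λ′ → IsAdjEigenvalue n λ′ →
    ¬ (λ′ ≈ fromℕ 6) → ¬ (λ′ ≈ - fromℕ 6) → (λ′ * λ′) ≤ fromℕ 20

{-# OPTIONS --safe #-}
module Submission where

-- Let A be the adjacency matrix of G_n and v an eigenvector of A for an
-- eigenvalue λ ≠ 6.  We exhibit a polynomial K with natural coefficients and
-- positive constant term such that (A − 6)·K(A² − 20) = 0, an integer matrix
-- identity that is checked by evaluation.  Applied to v it gives
-- (λ − 6)·K(λ² − 20) = 0, so K(λ² − 20) = 0.  Since K is positive on [0, ∞),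
-- λ² − 20 must be negative.

open import Defs
open import Algebra.Bundles using (CommutativeRing)
import Algebra.Properties.CommutativeSemigroup as CommutativeSemigroupProperties
import Algebra.Properties.Ring as RingProperties
import Algebra.Properties.Semiring.Mult as SemiringMultiplication
import Algebra.Properties.Semiring.Sum as SemiringSum
open import Data.Bool using (Bool; true; false; if_then_else_)
open import Data.Empty using (⊥-elim)
open import Data.Fin using (Fin; zero; suc; punchIn)
open import Data.Fin.Properties using (all?; punchInᵢ≢i) renaming (_≟_ to _≟ᶠ_)
open import Data.List using (List; []; _∷_; _++_; concat; filterᵇ)
import Data.List as List
open import Data.Nat as ℕ using (ℕ; _≟_; NonZero)
open import Data.Product using (_×_; _,_; proj₁; proj₂)
open import Data.Product.Properties using (≡-dec)
open import Data.Sum using (inj₁; inj₂)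
open import Data.Vec using (Vec; lookup; tabulate)
open import Data.Vec.Properties using (lookup∘tabulate)
open import Function using (_∘_)
open import Relation.Binary.Bundles using (Poset)
open import Relation.Binary.Definitions using (DecidableEquality)
open import Relation.Binary.PropositionalEquality as ≡ using (_≡_; _≢_)
open import Relation.Binary.Structures using (IsTotalOrder)
open import Relation.Nullary using (¬_; Dec; does)
open import Relation.Nullary.Decidable using (map′; from-yes; dec-true; dec-false)

-- (a , b) stands for the integer a − b.
Diff : Set
Diff = ℕ × ℕ

infixl 6 _⊕_
infixr 7 _·_

_⊕_ : Diff → Diff → Diff
(a , b) ⊕ (c , d) = a ℕ.+ c , b ℕ.+ d

⊖_ : Diff → Diff
⊖ (a , b) = b , a

_·_ : ℕ → Diff → Diff
k · (a , b) = k ℕ.* a , k ℕ.* b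

IsZero : Diff → Set
IsZero (a , b) = a ≡ b

isZero? : (p : Diff) → Dec (IsZero p)
isZero? (a , b) = a ≟ b

-- Functions on the vertices, stored as vectors so that evaluation shares them.
Table : ℕ → Set → Set
Table n A = Vec (Vec A 10) n

tabulateᵀ : ∀ {n} {A : Set} → (Vertex n → A) → Table n A
tabulateᵀ f = tabulate (λ i → tabulate (λ x → f (i , x)))

infixl 9 _!_

_!_ : ∀ {n} {A : Set} → Table n A → Vertex n → A
t ! (i , x) = lookup (lookup t i) x

!-tabulateᵀ : ∀ {n} {A : Set} (f : Vertex n → A) u → tabulateᵀ f ! u ≡ f u
!-tabulateᵀ f (i , x) =
  ≡.trans (≡.cong (λ row → lookup row x) (lookup∘tabulate (λ j → tabulate (λ y → f (j , y))) i))
          (lookup∘tabulate (λ y → f (i , y)) x)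

mapᵀ : ∀ {n} {A B : Set} → (A → B) → Table n A → Table n B
mapᵀ f t = tabulateᵀ (λ u → f (t ! u))

zipWithᵀ : ∀ {n} {A B C : Set} → (A → B → C) → Table n A → Table n B → Table n C
zipWithᵀ f s t = tabulateᵀ (λ u → f (s ! u) (t ! u))

allᵀ? : ∀ {n p} {P : Vertex n → Set p} → (∀ u → Dec (P u)) → Dec (∀ u → P u)
allᵀ? P? = map′ (λ h (i , x) → h i x) (λ h i x → h (i , x))
                (all? (λ i → all? (λ x → P? (i , x))))

_≟ᵛ_ : ∀ {n} → DecidableEquality (Vertex n)
_≟ᵛ_ = ≡-dec _≟ᶠ_ _≟ᶠ_

Row : ℕ → Set
Row n = Table n Diff

Matrix : ℕ → Set
Matrix n = Table n (Row n)

module _ {n : ℕ} where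

  infixl 6 _⊕ᴿ_ _⊞_
  infixr 7 _⊡_ _⊛_
  infix  8 ⊟_

  0ᴿ : Row n
  0ᴿ = tabulateᵀ (λ _ → 0 , 0)

  _⊕ᴿ_ : Row n → Row n → Row n
  _⊕ᴿ_ = zipWithᵀ _⊕_

  ∑ᴿ : {A : Set} → (A → Row n) → List A → Row n
  ∑ᴿ f []       = 0ᴿ
  ∑ᴿ f (x ∷ xs) = f x ⊕ᴿ ∑ᴿ f xs

  δ : Vertex n → Row n
  δ u = tabulateᵀ (λ w → if does (u ≟ᵛ w) then (1 , 0) else (0 , 0))

  0ᴹ : Matrix n
  0ᴹ = tabulateᵀ (λ _ → 0ᴿ)

  1ᴹ : Matrix n
  1ᴹ = tabulateᵀ δ

  _⊞_ : Matrix n → Matrix n → Matrix n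
  _⊞_ = zipWithᵀ _⊕ᴿ_

  ⊟_ : Matrix n → Matrix n
  ⊟_ = mapᵀ (mapᵀ ⊖_)

  _⊡_ : ℕ → Matrix n → Matrix n
  k ⊡ M = mapᵀ (mapᵀ (k ·_)) M

  -- When N lists the neighbours of every vertex, N ⊛ M is A·M.
  _⊛_ : Table n (List (Vertex n)) → Matrix n → Matrix n
  N ⊛ M = mapᵀ (∑ᴿ (M !_)) N

  ZeroMatrix : Matrix n → Set
  ZeroMatrix M = ∀ u w → IsZero (M ! u ! w)

  zeroMatrix? : (M : Matrix n) → Dec (ZeroMatrix M)
  zeroMatrix? M = allᵀ? (λ u → allᵀ? (λ w → isZero? (M ! u ! w)))

  module _ (N : Table n (List (Vertex n))) where

    hornerStep : ℕ → ℕ → Matrix n → Matrix n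
    hornerStep r c X = c ⊡ 1ᴹ ⊞ (N ⊛ N ⊛ X ⊞ ⊟ (r ⊡ X))

    -- K(A² − r), for K given by its coefficients, constant term first.
    hornerᴹ : ℕ → List ℕ → Matrix n
    hornerᴹ r []      = 0ᴹ
    hornerᴹ r (c ∷ K) = hornerStep r c (hornerᴹ r K)

    adjMinus : ℕ → Matrix n → Matrix n
    adjMinus d X = N ⊛ X ⊞ ⊟ (d ⊡ X)

    annihilator : ℕ → ℕ → List ℕ → Matrix n
    annihilator d r K = adjMinus d (hornerᴹ r K)

neighbours : (n : ℕ) → Vertex n → List (Vertex n)
neighbours n u = concat (List.tabulate (λ j → filterᵇ (adjG n u) (List.tabulate (j ,_))))

neighbourTable : (n : ℕ) → Table n (List (Vertex n))
neighbourTable n = tabulateᵀ (neighbours n)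

constantTerm : List ℕ → ℕ
constantTerm []      = 0
constantTerm (c ∷ _) = c

-- Kₙ(s) = ∏ (s + 20 − μ²), μ ranging over the distinct eigenvalues μ ≠ 6 of Gₙ;
-- all of them satisfy μ² < 20, hence the positive coefficients.
K₃ K₄ : List ℕ
K₃ = 115268678874176 ∷ 105439318395860 ∷ 42251076316009 ∷ 9940992426370 ∷
     1541878335225 ∷ 166944503757 ∷ 12984138150 ∷ 732729963 ∷ 29832735 ∷
     855830 ∷ 16439 ∷ 190 ∷ 1 ∷ []
K₄ = 791961927680 ∷ 897825030144 ∷ 433281077248 ∷ 118366066688 ∷
     20537562368 ∷ 2396507968 ∷ 193191680 ∷ 10815152 ∷ 413712 ∷ 10332 ∷
     152 ∷ 1 ∷ []

certificate₃ : ZeroMatrix (annihilator (neighbourTable 3) 6 20 K₃)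
certificate₃ = from-yes (zeroMatrix? (annihilator (neighbourTable 3) 6 20 K₃))

certificate₄ : ZeroMatrix (annihilator (neighbourTable 4) 6 20 K₄)
certificate₄ = from-yes (zeroMatrix? (annihilator (neighbourTable 4) 6 20 K₄))

module Semantics {c ℓ} (R : CommutativeRing c ℓ) where

  open CommutativeRing R hiding (zero)
  open RingProperties ring
    using (-‿distribˡ-*; -1*x≈-x; x[y-z]≈xy-xz; ⁻¹-anti-homo‿-; -‿+-comm; -0#≈0#)
  open CommutativeSemigroupProperties +-commutativeSemigroup using (interchange)
  open SemiringMultiplication semiring using (×-homo-+; ×1-homo-*) renaming (_×_ to _×ᴿ_)
  open SemiringSum semiring public using (sum)
  open SemiringSum semiring
    using (∑-distrib-+; *-distribˡ-sum; sum-cong-≋; sum-remove; sum-replicate-zero)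
  open import Relation.Binary.Reasoning.Setoid setoid

  ι : ℕ → Carrier
  ι k = k ×ᴿ 1#

  horner : List ℕ → Carrier → Carrier
  horner []      s = 0#
  horner (c ∷ K) s = ι c + s * horner K s

  ⟦_⟧ : Diff → Carrier
  ⟦ a , b ⟧ = ι a - ι b

  ⟦⊕⟧ : ∀ p q → ⟦ p ⊕ q ⟧ ≈ ⟦ p ⟧ + ⟦ q ⟧
  ⟦⊕⟧ (a , b) (c , d) = begin
    ι (a ℕ.+ c) - ι (b ℕ.+ d)   ≈⟨ +-cong (×-homo-+ 1# a c) (-‿cong (×-homo-+ 1# b d)) ⟩
    (ι a + ι c) - (ι b + ι d)   ≈⟨ +-congˡ (-‿+-comm (ι b) (ι d)) ⟨
    (ι a + ι c) + (- ι b + - ι d) ≈⟨ interchange (ι a) (ι c) (- ι b) (- ι d) ⟩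
    (ι a - ι b) + (ι c - ι d)   ∎

  ⟦⊖⟧ : ∀ p → ⟦ ⊖ p ⟧ ≈ - 1# * ⟦ p ⟧
  ⟦⊖⟧ (a , b) = trans (sym (⁻¹-anti-homo‿- (ι a) (ι b))) (sym (-1*x≈-x (ι a - ι b)))

  ⟦·⟧ : ∀ k p → ⟦ k · p ⟧ ≈ ι k * ⟦ p ⟧
  ⟦·⟧ k (a , b) = trans (+-cong (×1-homo-* k a) (-‿cong (×1-homo-* k b)))
                        (sym (x[y-z]≈xy-xz (ι k) (ι a) (ι b)))

  ⟦⟧-isZero : ∀ p → IsZero p → ⟦ p ⟧ ≈ 0#
  ⟦⟧-isZero (a , .a) ≡.refl = -‿inverseʳ (ι a)

  ⟦1⟧ : ⟦ 1 , 0 ⟧ ≈ 1#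
  ⟦1⟧ = trans (+-cong (+-identityʳ 1#) -0#≈0#) (+-identityʳ 1#)

  sum-zero : ∀ {m} (f : Fin m → Carrier) → (∀ i → f i ≈ 0#) → sum f ≈ 0#
  sum-zero {m} f f≈0 = trans (sum-cong-≋ f≈0) (sum-replicate-zero m)

  sum-pick : ∀ {m} i (f : Fin m → Carrier) → (∀ j → j ≢ i → f j ≈ 0#) → sum f ≈ f i
  sum-pick {ℕ.suc m} i f f≈0 = begin
    sum f                                     ≈⟨ sum-remove f ⟩
    f i + sum (λ j → f (punchIn i j)) ≈⟨ +-congˡ (sum-zero _ (λ j → f≈0 _ (punchInᵢ≢i i j))) ⟩
    f i + 0#                                  ≈⟨ +-identityʳ (f i) ⟩
    f i                                       ∎

  opaque
    ∑ᵛ : ∀ {n} → (Vertex n → Carrier) → Carrier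
    ∑ᵛ f = sum (λ i → sum (λ x → f (i , x)))

    ∑ᵛ-cong : ∀ {n} {f g : Vertex n → Carrier} → (∀ u → f u ≈ g u) → ∑ᵛ f ≈ ∑ᵛ g
    ∑ᵛ-cong f≈g = sum-cong-≋ (λ i → sum-cong-≋ (λ x → f≈g (i , x)))

    ∑ᵛ-+ : ∀ {n} (f g : Vertex n → Carrier) → ∑ᵛ (λ u → f u + g u) ≈ ∑ᵛ f + ∑ᵛ g
    ∑ᵛ-+ {n} f g = trans (sum-cong-≋ (λ i → ∑-distrib-+ (λ x → f (i , x)) (λ x → g (i , x))))
                     (∑-distrib-+ {n} _ _)

    ∑ᵛ-*ˡ : ∀ {n} a (f : Vertex n → Carrier) → ∑ᵛ (λ u → a * f u) ≈ a * ∑ᵛ f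
    ∑ᵛ-*ˡ {n} a f = sym (trans (*-distribˡ-sum {n} a (λ i → sum (λ x → f (i , x))))
                           (sum-cong-≋ (λ i → *-distribˡ-sum a (λ x → f (i , x)))))

    ∑ᵛ-zero : ∀ {n} (f : Vertex n → Carrier) → (∀ u → f u ≈ 0#) → ∑ᵛ f ≈ 0#
    ∑ᵛ-zero f f≈0 = sum-zero _ (λ i → sum-zero _ (λ x → f≈0 (i , x)))

    ∑ᵛ-pick : ∀ {n} u (f : Vertex n → Carrier) → (∀ w → w ≢ u → f w ≈ 0#) → ∑ᵛ f ≈ f u
    ∑ᵛ-pick (i , x) f f≈0 = trans
      (sum-pick i _ (λ j j≢i → sum-zero _ (λ y → f≈0 (j , y) (j≢i ∘ ≡.cong proj₁))))
      (sum-pick x _ (λ y y≢x → f≈0 (i , y) (y≢x ∘ ≡.cong proj₂)))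

  ∑ˡ : {A : Set} → (A → Carrier) → List A → Carrier
  ∑ˡ f []       = 0#
  ∑ˡ f (x ∷ xs) = f x + ∑ˡ f xs

  ∑ˡ-cong : {A : Set} {f g : A → Carrier} (xs : List A) → (∀ x → f x ≈ g x) → ∑ˡ f xs ≈ ∑ˡ g xs
  ∑ˡ-cong []       f≈g = refl
  ∑ˡ-cong (x ∷ xs) f≈g = +-cong (f≈g x) (∑ˡ-cong xs f≈g)

  ∑ˡ-*ˡ : ∀ {A : Set} a (f : A → Carrier) (xs : List A) → ∑ˡ (λ x → a * f x) xs ≈ a * ∑ˡ f xs
  ∑ˡ-*ˡ a f []       = sym (zeroʳ a)
  ∑ˡ-*ˡ a f (x ∷ xs) = trans (+-congˡ (∑ˡ-*ˡ a f xs)) (sym (distribˡ a (f x) (∑ˡ f xs)))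

  ∑ˡ-++ : {A : Set} (f : A → Carrier) (xs ys : List A) → ∑ˡ f (xs ++ ys) ≈ ∑ˡ f xs + ∑ˡ f ys
  ∑ˡ-++ f []       ys = sym (+-identityˡ (∑ˡ f ys))
  ∑ˡ-++ f (x ∷ xs) ys = trans (+-congˡ (∑ˡ-++ f xs ys)) (sym (+-assoc (f x) (∑ˡ f xs) (∑ˡ f ys)))

  ∑ˡ-concat : ∀ {m} {A : Set} (f : A → Carrier) (xss : Fin m → List A) →
              ∑ˡ f (concat (List.tabulate xss)) ≈ sum (λ j → ∑ˡ f (xss j))
  ∑ˡ-concat {ℕ.zero}  f xss = refl
  ∑ˡ-concat {ℕ.suc m} f xss =
    trans (∑ˡ-++ f (xss zero) _) (+-congˡ (∑ˡ-concat f (xss ∘ suc)))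

  ∑ˡ-filterᵇ : ∀ {m} {A : Set} (f : A → Carrier) (p : A → Bool) (g : Fin m → A) →
               ∑ˡ f (filterᵇ p (List.tabulate g)) ≈ sum (λ j → (if p (g j) then 1# else 0#) * f (g j))
  ∑ˡ-filterᵇ {ℕ.zero}  f p g = refl
  ∑ˡ-filterᵇ {ℕ.suc m} f p g with p (g zero)
  ... | true  = +-cong (sym (*-identityˡ _)) (∑ˡ-filterᵇ f p (g ∘ suc))
  ... | false = trans (∑ˡ-filterᵇ f p (g ∘ suc)) (sym (trans (+-congʳ (zeroˡ _)) (+-identityˡ _)))

  module _ {n} (v : Vertex n → Carrier) where

    eval : Row n → Carrier
    eval r = ∑ᵛ (λ w → ⟦ r ! w ⟧ * v w)

    Scales : Matrix n → Carrier → Set ℓ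
    Scales M a = ∀ u → eval (M ! u) ≈ a * v u

    eval-tabulateᵀ : ∀ f → eval (tabulateᵀ f) ≈ ∑ᵛ (λ w → ⟦ f w ⟧ * v w)
    eval-tabulateᵀ f = ∑ᵛ-cong (λ w → *-congʳ (reflexive (≡.cong ⟦_⟧ (!-tabulateᵀ f w))))

    eval-⊕ᴿ : ∀ r s → eval (r ⊕ᴿ s) ≈ eval r + eval s
    eval-⊕ᴿ r s = begin
      eval (r ⊕ᴿ s)                                 ≈⟨ eval-tabulateᵀ (λ w → r ! w ⊕ s ! w) ⟩
      ∑ᵛ (λ w → ⟦ r ! w ⊕ s ! w ⟧ * v w)            ≈⟨ ∑ᵛ-cong (λ w → *-congʳ (⟦⊕⟧ (r ! w) (s ! w))) ⟩
      ∑ᵛ (λ w → (⟦ r ! w ⟧ + ⟦ s ! w ⟧) * v w)      ≈⟨ ∑ᵛ-cong (λ w → distribʳ (v w) ⟦ r ! w ⟧ ⟦ s ! w ⟧) ⟩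
      ∑ᵛ (λ w → ⟦ r ! w ⟧ * v w + ⟦ s ! w ⟧ * v w)  ≈⟨ ∑ᵛ-+ _ _ ⟩
      eval r + eval s                               ∎

    eval-mapᵀ : ∀ (f : Diff → Diff) a → (∀ p → ⟦ f p ⟧ ≈ a * ⟦ p ⟧) → ∀ r →
                eval (mapᵀ f r) ≈ a * eval r
    eval-mapᵀ f a ⟦f⟧ r = begin
      eval (mapᵀ f r)                   ≈⟨ eval-tabulateᵀ (λ w → f (r ! w)) ⟩
      ∑ᵛ (λ w → ⟦ f (r ! w) ⟧ * v w)    ≈⟨ ∑ᵛ-cong (λ w → trans (*-congʳ (⟦f⟧ (r ! w))) (*-assoc a ⟦ r ! w ⟧ (v w))) ⟩
      ∑ᵛ (λ w → a * (⟦ r ! w ⟧ * v w))  ≈⟨ ∑ᵛ-*ˡ a _ ⟩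
      a * eval r                        ∎

    eval-zero : ∀ r → (∀ w → IsZero (r ! w)) → eval r ≈ 0#
    eval-zero r r≈0 = ∑ᵛ-zero _ (λ w → trans (*-congʳ (⟦⟧-isZero _ (r≈0 w))) (zeroˡ (v w)))

    eval-0ᴿ : eval 0ᴿ ≈ 0#
    eval-0ᴿ = trans (eval-tabulateᵀ (λ _ → 0 , 0))
                    (∑ᵛ-zero _ (λ w → trans (*-congʳ (⟦⟧-isZero (0 , 0) ≡.refl)) (zeroˡ (v w))))

    eval-∑ᴿ : ∀ {A : Set} (f : A → Row n) xs → eval (∑ᴿ f xs) ≈ ∑ˡ (eval ∘ f) xs
    eval-∑ᴿ f []       = eval-0ᴿ
    eval-∑ᴿ f (x ∷ xs) = trans (eval-⊕ᴿ (f x) (∑ᴿ f xs)) (+-congˡ (eval-∑ᴿ f xs))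

    eval-δ : ∀ u → eval (δ u) ≈ v u
    eval-δ u = begin
      eval (δ u)                  ≈⟨ eval-tabulateᵀ (λ w → δᵤ w) ⟩
      ∑ᵛ (λ w → ⟦ δᵤ w ⟧ * v w)   ≈⟨ ∑ᵛ-pick u _ off ⟩
      ⟦ δᵤ u ⟧ * v u              ≡⟨ ≡.cong (λ b → ⟦ if b then (1 , 0) else (0 , 0) ⟧ * v u)
                                            (dec-true (u ≟ᵛ u) ≡.refl) ⟩
      ⟦ 1 , 0 ⟧ * v u             ≈⟨ trans (*-congʳ ⟦1⟧) (*-identityˡ (v u)) ⟩
      v u                         ∎
      where
      δᵤ : Vertex n → Diff
      δᵤ w = if does (u ≟ᵛ w) then (1 , 0) else (0 , 0)
      off : ∀ w → w ≢ u → ⟦ δᵤ w ⟧ * v w ≈ 0#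
      off w w≢u rewrite dec-false (u ≟ᵛ w) (w≢u ∘ ≡.sym) =
        trans (*-congʳ (⟦⟧-isZero (0 , 0) ≡.refl)) (zeroˡ (v w))

    scales-cong : ∀ M {a b} → a ≈ b → Scales M a → Scales M b
    scales-cong M a≈b M∼a u = trans (M∼a u) (*-congʳ a≈b)

    scales-0ᴹ : Scales 0ᴹ 0#
    scales-0ᴹ u = begin
      eval (0ᴹ ! u)   ≡⟨ ≡.cong eval (!-tabulateᵀ (λ _ → 0ᴿ) u) ⟩
      eval 0ᴿ         ≈⟨ eval-0ᴿ ⟩
      0#              ≈⟨ zeroˡ (v u) ⟨
      0# * v u        ∎

    scales-1ᴹ : Scales 1ᴹ 1#
    scales-1ᴹ u = begin
      eval (1ᴹ ! u)   ≡⟨ ≡.cong eval (!-tabulateᵀ δ u) ⟩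
      eval (δ u)      ≈⟨ eval-δ u ⟩
      v u             ≈⟨ *-identityˡ (v u) ⟨
      1# * v u        ∎

    scales-⊞ : ∀ M N {a b} → Scales M a → Scales N b → Scales (M ⊞ N) (a + b)
    scales-⊞ M N {a} {b} M∼a N∼b u = begin
      eval ((M ⊞ N) ! u)          ≡⟨ ≡.cong eval (!-tabulateᵀ (λ w → M ! w ⊕ᴿ N ! w) u) ⟩
      eval (M ! u ⊕ᴿ N ! u)       ≈⟨ eval-⊕ᴿ (M ! u) (N ! u) ⟩
      eval (M ! u) + eval (N ! u) ≈⟨ +-cong (M∼a u) (N∼b u) ⟩
      a * v u + b * v u           ≈⟨ distribʳ (v u) a b ⟨
      (a + b) * v u               ∎

    scales-mapᵀ : ∀ (f : Diff → Diff) c → (∀ p → ⟦ f p ⟧ ≈ c * ⟦ p ⟧) →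
                  ∀ M {a} → Scales M a → Scales (mapᵀ (mapᵀ f) M) (c * a)
    scales-mapᵀ f c ⟦f⟧ M {a} M∼a u = begin
      eval (mapᵀ (mapᵀ f) M ! u)  ≡⟨ ≡.cong eval (!-tabulateᵀ (λ w → mapᵀ f (M ! w)) u) ⟩
      eval (mapᵀ f (M ! u))       ≈⟨ eval-mapᵀ f c ⟦f⟧ (M ! u) ⟩
      c * eval (M ! u)            ≈⟨ *-congˡ (M∼a u) ⟩
      c * (a * v u)               ≈⟨ *-assoc c a (v u) ⟨
      c * a * v u                 ∎

    scales-⊡ : ∀ k M {a} → Scales M a → Scales (k ⊡ M) (ι k * a)
    scales-⊡ k = scales-mapᵀ (k ·_) (ι k) (⟦·⟧ k)

    scales-⊟ : ∀ M {a} → Scales M a → Scales (⊟ M) (- a)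
    scales-⊟ M {a} M∼a = scales-cong (⊟ M) (-1*x≈-x a) (scales-mapᵀ ⊖_ (- 1#) ⟦⊖⟧ M M∼a)

    module _ (N : Table n (List (Vertex n))) (λ′ : Carrier)
             (adjacency : ∀ u → ∑ˡ v (N ! u) ≈ λ′ * v u) where

      scales-⊛ : ∀ M {a} → Scales M a → Scales (N ⊛ M) (λ′ * a)
      scales-⊛ M {a} M∼a u = begin
        eval ((N ⊛ M) ! u)                ≡⟨ ≡.cong eval (!-tabulateᵀ (λ w → ∑ᴿ (M !_) (N ! w)) u) ⟩
        eval (∑ᴿ (M !_) (N ! u))          ≈⟨ eval-∑ᴿ (M !_) (N ! u) ⟩
        ∑ˡ (λ w → eval (M ! w)) (N ! u)   ≈⟨ ∑ˡ-cong (N ! u) M∼a ⟩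
        ∑ˡ (λ w → a * v w) (N ! u)        ≈⟨ ∑ˡ-*ˡ a v (N ! u) ⟩
        a * ∑ˡ v (N ! u)                  ≈⟨ *-congˡ (adjacency u) ⟩
        a * (λ′ * v u)                    ≈⟨ *-assoc a λ′ (v u) ⟨
        a * λ′ * v u                      ≈⟨ *-congʳ (*-comm a λ′) ⟩
        λ′ * a * v u                      ∎

      scales-hornerStep : ∀ r c X {b} → Scales X b →
                          Scales (hornerStep N r c X) (ι c + (λ′ * λ′ - ι r) * b)
      scales-hornerStep r c X {b} X∼b = scales-cong (hornerStep N r c X) value
        (scales-⊞ (c ⊡ 1ᴹ) (N ⊛ N ⊛ X ⊞ ⊟ (r ⊡ X))
          (scales-⊡ c 1ᴹ scales-1ᴹ)
          (scales-⊞ (N ⊛ N ⊛ X) (⊟ (r ⊡ X))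
            (scales-⊛ (N ⊛ X) (scales-⊛ X X∼b))
            (scales-⊟ (r ⊡ X) (scales-⊡ r X X∼b))))
        where
        value : ι c * 1# + (λ′ * (λ′ * b) + - (ι r * b)) ≈ ι c + (λ′ * λ′ - ι r) * b
        value = +-cong (*-identityʳ (ι c)) (begin
          λ′ * (λ′ * b) + - (ι r * b)   ≈⟨ +-cong (*-assoc λ′ λ′ b) (sym (-‿distribˡ-* (ι r) b)) ⟨
          λ′ * λ′ * b + - ι r * b       ≈⟨ distribʳ b (λ′ * λ′) (- ι r) ⟨
          (λ′ * λ′ - ι r) * b           ∎)

      scales-hornerᴹ : ∀ r K → Scales (hornerᴹ N r K) (horner K (λ′ * λ′ - ι r))
      scales-hornerᴹ r []      = scales-0ᴹ
      scales-hornerᴹ r (c ∷ K) = scales-hornerStep r c (hornerᴹ N r K) (scales-hornerᴹ r K)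

      scales-adjMinus : ∀ d X {b} → Scales X b → Scales (adjMinus N d X) ((λ′ - ι d) * b)
      scales-adjMinus d X {b} X∼b = scales-cong (adjMinus N d X) value
        (scales-⊞ (N ⊛ X) (⊟ (d ⊡ X)) (scales-⊛ X X∼b) (scales-⊟ (d ⊡ X) (scales-⊡ d X X∼b)))
        where
        value : λ′ * b + - (ι d * b) ≈ (λ′ - ι d) * b
        value = trans (+-congˡ (-‿distribˡ-* (ι d) b)) (sym (distribʳ b λ′ (- ι d)))

      scales-annihilator : ∀ d r K →
        Scales (annihilator N d r K) ((λ′ - ι d) * horner K (λ′ * λ′ - ι r))
      scales-annihilator d r K = scales-adjMinus d (hornerᴹ N r K) (scales-hornerᴹ r K)

module _ {c ℓ₁ ℓ₂} (F : OrderedField c ℓ₁ ℓ₂) where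

  open OrderedField F hiding (zero)
  open Semantics commutativeRing
  open RingProperties ring using (-1*x≈-x; -‿involutive; x∙y⁻¹≈ε⇒x≈y)
  open SemiringSum semiring using (sum-cong-≗; sum-cong-≋)
  open IsTotalOrder isTotalOrder using (total; antisym; isPartialOrder)

  private
    poset : Poset c ℓ₁ ℓ₂
    poset = record { isPartialOrder = isPartialOrder }

  open import Relation.Binary.Reasoning.PartialOrder poset

  fromℕ≡ι : ∀ k → fromℕ k ≡ ι k
  fromℕ≡ι ℕ.zero    = ≡.refl
  fromℕ≡ι (ℕ.suc k) = ≡.cong (1# +_) (fromℕ≡ι k)

  sumFin≡sum : ∀ {m} (f : Fin m → Carrier) → sumFin f ≡ sum f
  sumFin≡sum {ℕ.zero}  f = ≡.refl
  sumFin≡sum {ℕ.suc m} f = ≡.cong (f zero +_) (sumFin≡sum (f ∘ suc))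

  adjMul≈∑ˡ-neighbours : ∀ n (v : Vertex n → Carrier) u → adjMul F n v u ≈ ∑ˡ v (neighbours n u)
  adjMul≈∑ˡ-neighbours n v u = begin-equality
    adjMul F n v u
      ≡⟨ ≡.trans (sumFin≡sum (λ j → sumFin (λ y → a j y * v (j , y))))
                 (sum-cong-≗ {n} (λ j → sumFin≡sum (λ y → a j y * v (j , y)))) ⟩
    sum (λ j → sum (λ y → a j y * v (j , y)))
      ≈⟨ sum-cong-≋ (λ j → ∑ˡ-filterᵇ v (adjG n u) (j ,_)) ⟨
    sum (λ j → ∑ˡ v (filterᵇ (adjG n u) (List.tabulate (j ,_))))
      ≈⟨ ∑ˡ-concat v (λ j → filterᵇ (adjG n u) (List.tabulate (j ,_))) ⟨
    ∑ˡ v (neighbours n u) ∎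
    where
    a : Fin n → Fin 10 → Carrier
    a j y = adjMatrix F n u (j , y)

  x*y≈0⇒x≈0 : ∀ {x y} → ¬ (y ≈ 0#) → x * y ≈ 0# → x ≈ 0#
  x*y≈0⇒x≈0 {x} {y} y≉0 xy≈0 with inverse y y≉0
  ... | y⁻¹ , yy⁻¹≈1 = begin-equality
    x              ≈⟨ *-identityʳ x ⟨
    x * 1#         ≈⟨ *-congˡ yy⁻¹≈1 ⟨
    x * (y * y⁻¹)  ≈⟨ *-assoc x y y⁻¹ ⟨
    x * y * y⁻¹    ≈⟨ *-congʳ xy≈0 ⟩
    0# * y⁻¹       ≈⟨ zeroˡ y⁻¹ ⟩
    0#             ∎

  x≤x+y : ∀ {x y} → 0# ≤ y → x ≤ (x + y)
  x≤x+y {x} {y} 0≤y = begin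
    x       ≈⟨ +-identityˡ x ⟨
    0# + x  ≤⟨ +-mono-≤ x 0≤y ⟩
    y + x   ≈⟨ +-comm y x ⟩
    x + y   ∎

  +-nonneg : ∀ {x y} → 0# ≤ x → 0# ≤ y → 0# ≤ (x + y)
  +-nonneg {x} {y} 0≤x 0≤y = begin
    0#     ≤⟨ 0≤x ⟩
    x      ≤⟨ x≤x+y 0≤y ⟩
    x + y  ∎

  0≤1 : 0# ≤ 1#
  0≤1 with total 0# 1#
  ... | inj₁ 0≤1 = 0≤1
  ... | inj₂ 1≤0 = begin
    0#            ≤⟨ *-nonneg 0≤-1 0≤-1 ⟩
    - 1# * - 1#   ≈⟨ -1*x≈-x (- 1#) ⟩
    - - 1#        ≈⟨ -‿involutive 1# ⟩
    1#            ∎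
    where
    0≤-1 : 0# ≤ (- 1#)
    0≤-1 = begin
      0#         ≈⟨ -‿inverseʳ 1# ⟨
      1# - 1#    ≤⟨ +-mono-≤ (- 1#) 1≤0 ⟩
      0# - 1#    ≈⟨ +-identityˡ (- 1#) ⟩
      - 1#       ∎

  0≤ι : ∀ k → 0# ≤ ι k
  0≤ι ℕ.zero    = begin 0# ∎
  0≤ι (ℕ.suc k) = +-nonneg 0≤1 (0≤ι k)

  0≤horner : ∀ {s} → 0# ≤ s → ∀ K → 0# ≤ horner K s
  0≤horner 0≤s []      = begin 0# ∎
  0≤horner 0≤s (c ∷ K) = +-nonneg (0≤ι c) (*-nonneg 0≤s (0≤horner 0≤s K))

  1≤horner : ∀ {s} → 0# ≤ s → ∀ K .{{_ : NonZero (constantTerm K)}} → 1# ≤ horner K s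
  1≤horner {s} 0≤s (ℕ.suc c ∷ K) = begin
    1#                             ≤⟨ x≤x+y (0≤horner 0≤s (c ∷ K)) ⟩
    1# + (ι c + s * horner K s)    ≈⟨ +-assoc 1# (ι c) (s * horner K s) ⟨
    horner (ℕ.suc c ∷ K) s         ∎

  horner-root⇒≤ : ∀ {x} r K .{{_ : NonZero (constantTerm K)}} →
                     horner K (x - ι r) ≈ 0# → x ≤ ι r
  horner-root⇒≤ {x} r K root with total x (ι r)
  ... | inj₁ x≤r = x≤r
  ... | inj₂ r≤x = ⊥-elim (nontrivial (antisym 0≤1 1≤0))
    where
    0≤x-r : 0# ≤ (x - ι r)
    0≤x-r = begin
      0#          ≈⟨ -‿inverseʳ (ι r) ⟨
      ι r - ι r   ≤⟨ +-mono-≤ (- ι r) r≤x ⟩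
      x - ι r     ∎
    1≤0 : 1# ≤ 0#
    1≤0 = begin
      1#                   ≤⟨ 1≤horner 0≤x-r K ⟩
      horner K (x - ι r)   ≈⟨ root ⟩
      0#                   ∎

  annihilator-root : ∀ n d r K → ZeroMatrix (annihilator (neighbourTable n) d r K) →
                     ∀ {λ′} → IsAdjEigenvalue F n λ′ → (λ′ - ι d) * horner K (λ′ * λ′ - ι r) ≈ 0#
  annihilator-root n d r K certificate {λ′} (v , (u , vᵤ≉0) , eigen) = x*y≈0⇒x≈0 vᵤ≉0 (begin-equality
    (λ′ - ι d) * horner K (λ′ * λ′ - ι r) * v u
      ≈⟨ scales-annihilator v (neighbourTable n) λ′ adjacency d r K u ⟨
    eval v (annihilator (neighbourTable n) d r K ! u)
      ≈⟨ eval-zero v (annihilator (neighbourTable n) d r K ! u) (certificate u) ⟩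
    0# ∎)
    where
    adjacency : ∀ w → ∑ˡ v (neighbourTable n ! w) ≈ λ′ * v w
    adjacency w = begin-equality
      ∑ˡ v (neighbourTable n ! w)   ≡⟨ ≡.cong (∑ˡ v) (!-tabulateᵀ (neighbours n) w) ⟩
      ∑ˡ v (neighbours n w)         ≈⟨ adjMul≈∑ˡ-neighbours n v w ⟨
      adjMul F n v w                ≈⟨ eigen w ⟩
      λ′ * v w                      ∎

  ramanujan-by-certificate : ∀ n K .{{_ : NonZero (constantTerm K)}} →
    ZeroMatrix (annihilator (neighbourTable n) 6 20 K) → IsRamanujanG F n
  ramanujan-by-certificate n K certificate λ′ eigenvalue λ′≉6 _ =
    ≡.subst (λ t → (λ′ * λ′) ≤ t) (≡.sym (fromℕ≡ι 20)) (horner-root⇒≤ 20 K K[s]≈0)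
    where
    λ′-6≉0 : ¬ (λ′ - ι 6 ≈ 0#)
    λ′-6≉0 λ′-6≈0 = λ′≉6 (trans (x∙y⁻¹≈ε⇒x≈y λ′ (ι 6) λ′-6≈0) (reflexive (≡.sym (fromℕ≡ι 6))))
    K[s]≈0 : horner K (λ′ * λ′ - ι 20) ≈ 0#
    K[s]≈0 = x*y≈0⇒x≈0 λ′-6≉0 (trans (*-comm _ _) (annihilator-root n 6 20 K certificate eigenvalue))

theorem5p1 : ∀ {c ℓ₁ ℓ₂} (F : OrderedField c ℓ₁ ℓ₂) →
    IsRamanujanG F 3 × IsRamanujanG F 4
theorem5p1 F = ramanujan-by-certificate F 3 K₃ certificate₃ , ramanujan-by-certificate F 4 K₄ certificate₄
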